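{- Let $n\ge1$, $\sigma\in\mathfrak{D}_{n+1}$ and $i\in[2n-1]$, and let $\sigma'=\sigma\circ(e_i,e_{i+1})$, where $(e_i,e_{i+1})$ is the transposition of $[2n+2]$ exchanging the integers $e_i$ and $e_{i+1}$. Then $\varphi(\sigma)$ is switchable at $i$ if and only if $\sigma'\in\mathfrak{D}_{n+1}$, and in that case $\varphi(\sigma')=Sw^i(\varphi(\sigma))$.
   Context: A Dumont permutation of order $2m$ is $\sigma\in\mathfrak{S}_{2m}$ with $\sigma(2i)<2i$ and $\sigma(2i-1)>2i-1$ for all $i\in[m]$; $\mathfrak{D}_m$ is their set. Grids and labels: consider grids with $n$ columns (indexed $1..n$ left to right) and $2n$ rows (indexed $1..2n$ bottom to top); row $i\le n$ carries the label $e_i=2i+2$ and row $n+i$ ($i\in[n]$) carries the label $e_{n+i}=2i-1$; a dot in a row is identified with the row's label. A Dellac configuration of size $n$ is such a grid with $2n$ dots, exactly one per row and two per column, each dot in column $j$, row $i$ satisfying $j\le i\le j+n$; $DC(n)$ is their set. For $\sigma\in\mathfrak{D}_{n+1}$, $\varphi(\sigma)$ is the grid whose $j$-th column ($j\in[n]$) contains exactly the dots labelled $\sigma^{ -1}(2j)$ and $\sigma^{ -1}(2j+1)$; it is a Dellac configuration. Switching: for $C\in DC(n)$ and $i\in[2n-1]$, $Sw^i(C)$ is the grid obtained by exchanging the columns of the dots $e_i$ and $e_{i+1}$ (the dot of row $i$ is moved to the column of the dot of row $i+1$ and vice versa). $C$ is switchable at $i$ if $Sw^i(C)$ is again a Dellac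 configuration. -}

module Defs where

open import Data.Nat using (ℕ; zero; suc; _+_; _*_; _∸_; _≤_; _<_; _≤ᵇ_; _≡ᵇ_)
open import Data.Bool using (if_then_else_)
open import Data.Product using (Σ; ∃; _×_; _,_)
open import Data.Sum using (_⊎_)
open import Relation.Binary.PropositionalEquality using (_≡_; _≢_)

InRange : ℕ → ℕ → Set
InRange N x = 1 ≤ x × x ≤ N

record IsPerm (N : ℕ) (f : ℕ → ℕ) : Set where
  field
    maps-into : ∀ x → InRange N x → InRange N (f x)
    injective : ∀ x y → InRange N x → InRange N y → f x ≡ f y → x ≡ y
    surjective : ∀ y → InRange N y → Σ ℕ λ x → InRange N x × f x ≡ y
    id-outside : ∀ x → x ≡ 0 ⊎ N < x → f x ≡ x

record IsDumont (m : ℕ) (σ : ℕ → ℕ) : Set where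
  field
    perm : IsPerm (2 * m) σ
    even-cond : ∀ i → 1 ≤ i → i ≤ m → σ (2 * i) < 2 * i
    odd-cond  : ∀ i → 1 ≤ i → i ≤ m → 2 * i ∸ 1 < σ (2 * i ∸ 1)

_∈𝔇_ : (ℕ → ℕ) → ℕ → Set
σ ∈𝔇 m = IsDumont m σ

_∘ᶠ_ : (ℕ → ℕ) → (ℕ → ℕ) → ℕ → ℕ
(σ ∘ᶠ τ) x = σ (τ x)

transp : ℕ → ℕ → ℕ → ℕ
transp a b x = if x ≡ᵇ a then b else (if x ≡ᵇ b then a else x)

-- row labels for grids of size n:  e_i = 2i+2 (i ≤ n),  e_{n+i} = 2i-1
e : ℕ → ℕ → ℕ
e n r = if r ≤ᵇ n then 2 * r + 2 else 2 * (r ∸ n) ∸ 1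

-- A grid with n columns and 2n rows, given by the set of its dots:
-- G r j holds iff there is a dot in row r, column j (both 1-based).
Grid : Set₁
Grid = ℕ → ℕ → Set

record IsDellac (n : ℕ) (G : Grid) : Set where
  field
    in-grid : ∀ r j → G r j → InRange (2 * n) r × InRange n j
    one-per-row : ∀ r → InRange (2 * n) r →
      Σ ℕ λ j → G r j × (∀ j' → G r j' → j' ≡ j)
    two-per-column : ∀ j → InRange n j →
      Σ ℕ λ r₁ → Σ ℕ λ r₂ → r₁ < r₂ × G r₁ j × G r₂ j ×
        (∀ r → G r j → r ≡ r₁ ⊎ r ≡ r₂)
    band : ∀ r j → G r j → j ≤ r × r ≤ j + n

-- φ(σ): column j ∈ [n] contains exactly the dots labelled σ⁻¹(2j) and σ⁻¹(2j+1),
-- i.e. the dot of row r (label e_r) is in column j iff σ(e_r) ∈ {2j, 2j+1}.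
φ : ℕ → (ℕ → ℕ) → Grid
φ n σ r j = InRange (2 * n) r × InRange n j ×
            (σ (e n r) ≡ 2 * j ⊎ σ (e n r) ≡ 2 * j + 1)

Sw : ℕ → Grid → Grid
Sw i C r j = (r ≢ i × r ≢ suc i × C r j)
           ⊎ (r ≡ i × C (suc i) j)
           ⊎ (r ≡ suc i × C i j)

Switchable : ℕ → Grid → ℕ → Set
Switchable n C i = IsDellac n (Sw i C)

_≈G_ : Grid → Grid → Set
G ≈G H = ∀ r j → (G r j → H r j) × (H r j → G r j)

module Submission where

-- Put σ' = σ ∘ (e_i e_{i+1}).  Directly from the definitions, the dot of
-- row r of φ(σ') lies where the dot of row r of φ(σ) lies, except that rows i
-- and i+1 have exchanged columns: φ(σ') = Sw^i(φ(σ)) as sets of dots, for every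
-- σ whatsoever.  So the theorem reduces to: φ(σ') is a Dellac configuration iff
-- σ' is a Dumont permutation.  Call a permutation τ of [2n+2] anchored if
-- τ(2) = 1 and τ(2n+1) = 2n+2.  Dumont permutations are anchored, and since the
-- labels e_r never equal 2 or 2n+1, σ' is anchored as well.  For an anchored τ
-- the grid φ(τ) always has one dot per row and two per column (the labels
-- enumerate [2n+2] ∖ {2, 2n+1}, the columns partition [2n+2] ∖ {1, 2n+2}), and
-- its band condition is exactly the Dumont condition.

open import Defs
open import Data.Nat
  using (ℕ; zero; suc; s≤s⁻¹; _+_; _*_; _∸_; _≤_; _<_; z≤n; s≤s; _≤ᵇ_; _≡ᵇ_; _≟_; _≤?_)
open import Data.Nat.Properties
open import Data.Bool using (true; false; T)
open import Data.Unit using (tt)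
open import Data.Product using (_×_; _,_; Σ; proj₁; proj₂)
open import Data.Sum using (_⊎_; inj₁; inj₂; swap)
open import Data.Empty using (⊥-elim)
open import Relation.Nullary using (yes; no)
open import Relation.Binary.PropositionalEquality
open import Relation.Binary.Definitions using (Tri; tri<; tri≈; tri>)
open import Function.Bundles using (_⇔_; mk⇔; Equivalence)

double-suc : ∀ a → 2 * suc a ≡ suc (suc (2 * a))
double-suc a = *-suc 2 a

odd-form : ∀ j → 2 * j + 1 ≡ suc (2 * j)
odd-form j = +-comm (2 * j) 1

parity : ∀ x → Σ ℕ λ q → x ≡ 2 * q ⊎ x ≡ suc (2 * q)
parity zero = 0 , inj₁ refl
parity (suc x) with parity x
... | q , inj₁ eq = q , inj₂ (cong suc eq)
... | q , inj₂ eq = suc q , inj₁ (trans (cong suc eq) (sym (double-suc q)))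

half-≤ : ∀ {a b} → 2 * a ≤ suc (2 * b) → a ≤ b
half-≤ {a} {b} h =
  s≤s⁻¹ (*-cancelˡ-< 2 a (suc b) (subst (suc (2 * a) ≤_) (sym (double-suc b)) (s≤s h)))

e-low : ∀ {n r} → r ≤ n → e n r ≡ 2 * suc r
e-low {n} {r} r≤n with r ≤ᵇ n | ≤⇒≤ᵇ r≤n
... | true | _ = trans (+-comm (2 * r) 2) (sym (double-suc r))

e-high : ∀ n t → e n (n + suc t) ≡ suc (2 * t)
e-high n t with (n + suc t) ≤ᵇ n in eq
... | true = ⊥-elim (m+1+n≰m n (≤ᵇ⇒≤ (n + suc t) n (subst T (sym eq) tt)))
... | false rewrite m+n∸m≡n n (suc t) = cong (_∸ 1) (double-suc t)

low-row-range : ∀ {n r} → 1 ≤ r → r ≤ n → InRange (2 * n) r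
low-row-range {n} 1≤r r≤n = 1≤r , ≤-trans r≤n (m≤m+n n (n + 0))

high-row-range : ∀ {n t} → t < n → InRange (2 * n) (n + suc t)
high-row-range {n} {t} t<n =
  ≤-trans (s≤s z≤n) (m≤n+m (suc t) n) , +-monoʳ-≤ n (subst (suc t ≤_) (sym (+-identityʳ n)) t<n)

data RowView (n r : ℕ) : Set where
  low  : 1 ≤ r → r ≤ n → RowView n r
  high : ∀ t → t < n → r ≡ n + suc t → RowView n r

rowView : ∀ n r → InRange (2 * n) r → RowView n r
rowView n r (1≤r , r≤2n) with r ≤? n
... | yes r≤n = low 1≤r r≤n
... | no r≰n with r ∸ n in eq
...   | zero = ⊥-elim (r≰n (m∸n≡0⇒m≤n eq))
...   | suc t = high t t<n r≡
  where
  r≡ : r ≡ n + suc t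
  r≡ = trans (sym (m+[n∸m]≡n (<⇒≤ (≰⇒> r≰n)))) (cong (n +_) eq)
  t<n : t < n
  t<n = +-cancelˡ-≤ n (suc t) n (subst (_≤ n + n) r≡ (subst (r ≤_) (cong (n +_) (+-identityʳ n)) r≤2n))

label-range : ∀ n r → InRange (2 * n) r → InRange (2 * suc n) (e n r)
label-range n r rr with rowView n r rr
... | low _ r≤n rewrite e-low r≤n | double-suc r | double-suc n =
  s≤s z≤n , s≤s (s≤s (*-monoʳ-≤ 2 r≤n))
... | high t t<n refl rewrite e-high n t | double-suc n =
  s≤s z≤n , m≤n⇒m≤1+n (s≤s (*-monoʳ-≤ 2 (<⇒≤ t<n)))

label≢2 : ∀ n r → InRange (2 * n) r → e n r ≢ 2
label≢2 n r rr with rowView n r rr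
... | low 1≤r r≤n rewrite e-low r≤n = λ eq → <⇒≢ 1≤r (sym (suc-injective (*-cancelˡ-≡ (suc r) 1 2 eq)))
... | high t _ refl rewrite e-high n t = λ eq → even≢odd 1 t (sym eq)

label≢top : ∀ n r → InRange (2 * n) r → e n r ≢ suc (2 * n)
label≢top n r rr with rowView n r rr
... | low _ r≤n rewrite e-low r≤n = even≢odd (suc r) n
... | high t t<n refl rewrite e-high n t = λ eq → <⇒≢ t<n (*-cancelˡ-≡ t n 2 (suc-injective eq))

label-injective : ∀ n r r' → InRange (2 * n) r → InRange (2 * n) r' → e n r ≡ e n r' → r ≡ r'
label-injective n r r' rr rr' eq with rowView n r rr | rowView n r' rr'
... | low _ p | low _ p' rewrite e-low p | e-low p' = suc-injective (*-cancelˡ-≡ _ _ 2 eq)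
... | low _ p | high t' _ refl rewrite e-low p | e-high n t' = ⊥-elim (even≢odd (suc r) t' eq)
... | high t _ refl | low _ p' rewrite e-low p' | e-high n t = ⊥-elim (even≢odd (suc r') t (sym eq))
... | high t _ refl | high t' _ refl rewrite e-high n t | e-high n t' =
  cong (λ x → n + suc x) (*-cancelˡ-≡ t t' 2 (suc-injective eq))

label-surjective : ∀ n x → InRange (2 * suc n) x → x ≢ 2 → x ≢ suc (2 * n) →
  Σ ℕ λ r → InRange (2 * n) r × e n r ≡ x
label-surjective n x (1≤x , x≤top) x≢2 x≢t with parity x
... | zero , inj₁ refl with 1≤x
...   | ()
label-surjective n x _ x≢2 _ | suc zero , inj₁ refl = ⊥-elim (x≢2 refl)
label-surjective n x (_ , x≤top) _ _ | suc (suc k) , inj₁ refl =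
  suc k , low-row-range (s≤s z≤n) k<n , e-low k<n
  where
  k<n : suc k ≤ n
  k<n = s≤s⁻¹ (*-cancelˡ-≤ {suc (suc k)} {suc n} 2 x≤top)
label-surjective n x (_ , x≤top) _ x≢t | q , inj₂ refl =
  n + suc q , high-row-range q<n , e-high n q
  where
  q<n : q < n
  q<n with m≤n⇒m<n∨m≡n (half-≤ (s≤s⁻¹ (subst (suc (2 * q) ≤_) (double-suc n) x≤top)))
  ... | inj₁ q<n = q<n
  ... | inj₂ refl = ⊥-elim (x≢t refl)

adjacent-rows : ∀ n i → 1 ≤ i → i ≤ 2 * n ∸ 1 → InRange (2 * n) i × InRange (2 * n) (suc i)
adjacent-rows zero zero () _
adjacent-rows zero (suc _) _ ()
adjacent-rows (suc m) i 1≤i i≤ = (1≤i , m≤n⇒m≤1+n i≤) , (s≤s z≤n , s≤s i≤)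

InCol : ℕ → ℕ → Set
InCol v j = v ≡ 2 * j ⊎ v ≡ 2 * j + 1

InCol-lower : ∀ {v} j → InCol v j → 2 * j ≤ v
InCol-lower j (inj₁ refl) = ≤-refl
InCol-lower j (inj₂ refl) = m≤m+n (2 * j) 1

InCol-upper : ∀ {v} j → InCol v j → v ≤ suc (2 * j)
InCol-upper j (inj₁ refl) = n≤1+n _
InCol-upper j (inj₂ refl) = ≤-reflexive (odd-form j)

column-unique : ∀ {v j j'} → InCol v j → InCol v j' → j ≡ j'
column-unique {j = j} {j'} (inj₁ refl) (inj₁ q) = *-cancelˡ-≡ j j' 2 q
column-unique {j = j} {j'} (inj₁ refl) (inj₂ q) = ⊥-elim (even≢odd j j' (trans q (odd-form j')))
column-unique {j = j} {j'} (inj₂ refl) (inj₁ q) = ⊥-elim (even≢odd j' j (trans (sym q) (odd-form j)))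
column-unique {j = j} {j'} (inj₂ refl) (inj₂ q) =
  *-cancelˡ-≡ j j' 2 (suc-injective (trans (sym (odd-form j)) (trans q (odd-form j'))))

column-of : ∀ n v → InRange (2 * suc n) v → v ≢ 1 → v ≢ 2 * suc n →
  Σ ℕ λ j → InRange n j × InCol v j
column-of n v (1≤v , v≤top) v≢1 v≢t with parity v
... | zero , inj₁ refl with 1≤v
...   | ()
column-of n v _ v≢1 _ | zero , inj₂ refl = ⊥-elim (v≢1 refl)
column-of n v (_ , v≤top) _ v≢t | suc q , inj₁ refl = suc q , (s≤s z≤n , q<n) , inj₁ refl
  where
  q<n : suc q ≤ n
  q<n with m≤n⇒m<n∨m≡n (*-cancelˡ-≤ {suc q} {suc n} 2 v≤top)
  ... | inj₁ (s≤s q<n) = q<n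
  ... | inj₂ refl = ⊥-elim (v≢t refl)
column-of n v (_ , v≤top) _ _ | suc q , inj₂ refl =
  suc q , (s≤s z≤n , half-≤ (s≤s⁻¹ (subst (suc (2 * suc q) ≤_) (double-suc n) v≤top))) ,
  inj₂ (sym (odd-form (suc q)))

column-values : ∀ n j → InRange n j → ∀ v → InCol v j →
  InRange (2 * suc n) v × v ≢ 1 × v ≢ 2 * suc n
column-values n j (1≤j , j≤n) v c =
  (≤-trans 1≤j (≤-trans (m≤m+n j (j + 0)) (InCol-lower j c)) ,
   ≤-trans (InCol-upper j c)
     (subst (suc (2 * j) ≤_) (sym (double-suc n)) (m≤n⇒m≤1+n (s≤s (*-monoʳ-≤ 2 j≤n))))) ,
  (λ v≡1 → 1+n≰n (≤-trans 1≤j (half-≤ {j} {0} (subst (2 * j ≤_) v≡1 (InCol-lower j c))))) ,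
  (λ v≡t → 1+n≰n (subst (_≤ suc (2 * j)) (double-suc j)
    (≤-trans (*-monoʳ-≤ 2 (s≤s j≤n)) (≤-trans (≤-reflexive (sym v≡t)) (InCol-upper j c)))))

transp-left : ∀ a b → transp a b a ≡ b
transp-left a b with a ≡ᵇ a | ≡⇒≡ᵇ a a refl
... | true | _ = refl

transp-right : ∀ a b → transp a b b ≡ a
transp-right a b with b ≡ᵇ a in eq
... | true = ≡ᵇ⇒≡ b a (subst T (sym eq) tt)
... | false with b ≡ᵇ b | ≡⇒≡ᵇ b b refl
...   | true | _ = refl

transp-other : ∀ a b x → x ≢ a → x ≢ b → transp a b x ≡ x
transp-other a b x x≢a x≢b with x ≡ᵇ a in eq
... | true = ⊥-elim (x≢a (≡ᵇ⇒≡ x a (subst T (sym eq) tt)))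
... | false with x ≡ᵇ b in eq'
...   | true = ⊥-elim (x≢b (≡ᵇ⇒≡ x b (subst T (sym eq') tt)))
...   | false = refl

transp-involutive : ∀ a b x → transp a b (transp a b x) ≡ x
transp-involutive a b x with x ≟ a
... | yes refl rewrite transp-left x b = transp-right x b
... | no x≢a with x ≟ b
...   | yes refl rewrite transp-right a x = transp-left a x
...   | no x≢b rewrite transp-other a b x x≢a x≢b = transp-other a b x x≢a x≢b

outside≢inside : ∀ N a x → InRange N a → x ≡ 0 ⊎ N < x → x ≢ a
outside≢inside N a x (1≤a , _) (inj₁ refl) refl with 1≤a
... | ()
outside≢inside N a x (_ , a≤N) (inj₂ N<x) refl = <⇒≢ (<-≤-trans N<x a≤N) refl

transp-isPerm : ∀ N a b → InRange N a → InRange N b → IsPerm N (transp a b)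
transp-isPerm N a b ra rb = record
  { maps-into = stays
  ; injective = λ x y _ _ eq →
      trans (sym (transp-involutive a b x)) (trans (cong (transp a b) eq) (transp-involutive a b y))
  ; surjective = λ y ry → transp a b y , stays y ry , transp-involutive a b y
  ; id-outside = λ x out → transp-other a b x (outside≢inside N a x ra out) (outside≢inside N b x rb out)
  }
  where
  stays : ∀ x → InRange N x → InRange N (transp a b x)
  stays x rx with x ≟ a
  ... | yes refl rewrite transp-left x b = rb
  ... | no x≢a with x ≟ b
  ...   | yes refl rewrite transp-right a x = ra
  ...   | no x≢b rewrite transp-other a b x x≢a x≢b = rx

∘-isPerm : ∀ N σ τ → IsPerm N σ → IsPerm N τ → IsPerm N (σ ∘ᶠ τ)
∘-isPerm N σ τ Pσ Pτ = record
  { maps-into = λ x rx → IsPerm.maps-into Pσ (τ x) (IsPerm.maps-into Pτ x rx)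
  ; injective = λ x y rx ry eq → IsPerm.injective Pτ x y rx ry
      (IsPerm.injective Pσ (τ x) (τ y) (IsPerm.maps-into Pτ x rx) (IsPerm.maps-into Pτ y ry) eq)
  ; surjective = surjective
  ; id-outside = λ x out → trans (cong σ (IsPerm.id-outside Pτ x out)) (IsPerm.id-outside Pσ x out)
  }
  where
  surjective : ∀ y → InRange N y → Σ ℕ λ x → InRange N x × σ (τ x) ≡ y
  surjective y ry with IsPerm.surjective Pσ y ry
  ... | z , rz , σz≡y with IsPerm.surjective Pτ z rz
  ...   | x , rx , τx≡z = x , rx , trans (cong σ τx≡z) σz≡y

SingleDotInRow : Grid → ℕ → Set
SingleDotInRow G r = Σ ℕ λ j → G r j × (∀ j' → G r j' → j' ≡ j)

TwoDotsInColumn : Grid → ℕ → Set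
TwoDotsInColumn G j =
  Σ ℕ λ r₁ → Σ ℕ λ r₂ → r₁ < r₂ × G r₁ j × G r₂ j × (∀ r → G r j → r ≡ r₁ ⊎ r ≡ r₂)

record Anchored (n : ℕ) (τ : ℕ → ℕ) : Set where
  field
    perm   : IsPerm (2 * suc n) τ
    at-two : τ 2 ≡ 1
    at-top : τ (suc (2 * n)) ≡ 2 * suc n

two-range : ∀ n → InRange (2 * suc n) 2
two-range n rewrite double-suc n = s≤s z≤n , s≤s (s≤s z≤n)

top-range : ∀ n → InRange (2 * suc n) (suc (2 * n))
top-range n rewrite double-suc n = s≤s z≤n , n≤1+n _

top-odd : ∀ n → 2 * suc n ∸ 1 ≡ suc (2 * n)
top-odd n = cong (_∸ 1) (double-suc n)

-- The Dumont conditions at 2 and at 2n+1 leave only one possible value.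
dumont⇒anchored : ∀ n τ → τ ∈𝔇 suc n → Anchored n τ
dumont⇒anchored n τ D = record { perm = P ; at-two = at-two ; at-top = at-top }
  where
  P = IsDumont.perm D
  at-two : τ 2 ≡ 1
  at-two = ≤-antisym (s≤s⁻¹ (IsDumont.even-cond D 1 (s≤s z≤n) (s≤s z≤n)))
                     (proj₁ (IsPerm.maps-into P 2 (two-range n)))
  at-top : τ (suc (2 * n)) ≡ 2 * suc n
  at-top = ≤-antisym (proj₂ (IsPerm.maps-into P _ (top-range n)))
    (subst (_≤ τ (suc (2 * n))) (sym (double-suc n))
      (subst (λ z → z < τ z) (top-odd n) (IsDumont.odd-cond D (suc n) (s≤s z≤n) ≤-refl)))

-- Transposing two labels keeps a permutation anchored, as labels avoid 2 and 2n+1.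
anchored-transp : ∀ n τ r r' → Anchored n τ → InRange (2 * n) r → InRange (2 * n) r' →
  Anchored n (τ ∘ᶠ transp (e n r) (e n r'))
anchored-transp n τ r r' A rr rr' = record
  { perm = ∘-isPerm _ τ _ (Anchored.perm A)
             (transp-isPerm _ _ _ (label-range n r rr) (label-range n r' rr'))
  ; at-two = trans (cong τ (transp-other _ _ 2 (≢-sym (label≢2 n r rr)) (≢-sym (label≢2 n r' rr'))))
                   (Anchored.at-two A)
  ; at-top = trans (cong τ (transp-other _ _ _ (≢-sym (label≢top n r rr)) (≢-sym (label≢top n r' rr'))))
                   (Anchored.at-top A)
  }

module AnchoredGrid (n : ℕ) (τ : ℕ → ℕ) (A : Anchored n τ) where
  private
    P = Anchored.perm A

  -- τ(e_r) is never 1 nor 2n+2, so it lies in a column.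
  row-column : ∀ r → InRange (2 * n) r → Σ ℕ λ j → InRange n j × InCol (τ (e n r)) j
  row-column r rr = column-of n (τ (e n r)) (IsPerm.maps-into P _ er) ≢1 ≢top
    where
    er = label-range n r rr
    ≢1 : τ (e n r) ≢ 1
    ≢1 eq = label≢2 n r rr (IsPerm.injective P _ _ er (two-range n) (trans eq (sym (Anchored.at-two A))))
    ≢top : τ (e n r) ≢ 2 * suc n
    ≢top eq = label≢top n r rr (IsPerm.injective P _ _ er (top-range n) (trans eq (sym (Anchored.at-top A))))

  one-per-row : ∀ r → InRange (2 * n) r → SingleDotInRow (φ n τ) r
  one-per-row r rr with row-column r rr
  ... | j , rj , c = j , (rr , rj , c) , λ j' (_ , _ , c') → column-unique c' c

  row-of-value : ∀ y → InRange (2 * suc n) y → y ≢ 1 → y ≢ 2 * suc n →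
    Σ ℕ λ r → InRange (2 * n) r × τ (e n r) ≡ y
  row-of-value y ry y≢1 y≢t with IsPerm.surjective P y ry
  ... | x , rx , τx≡y with label-surjective n x rx x≢2 x≢t
    where
    x≢2 : x ≢ 2
    x≢2 refl = y≢1 (trans (sym τx≡y) (Anchored.at-two A))
    x≢t : x ≢ suc (2 * n)
    x≢t refl = y≢t (trans (sym τx≡y) (Anchored.at-top A))
  ... | r , rr , er≡x = r , rr , trans (cong τ er≡x) τx≡y

  row-unique : ∀ r r' → InRange (2 * n) r → InRange (2 * n) r' → τ (e n r) ≡ τ (e n r') → r ≡ r'
  row-unique r r' rr rr' eq =
    label-injective n r r' rr rr' (IsPerm.injective P _ _ (label-range n r rr) (label-range n r' rr') eq)

  two-per-column : ∀ j → InRange n j → TwoDotsInColumn (φ n τ) j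
  two-per-column j rj with column-values n j rj _ (inj₁ refl) | column-values n j rj _ (inj₂ refl)
  ... | (rv , v≢1 , v≢t) | (rw , w≢1 , w≢t)
    with row-of-value _ rv v≢1 v≢t | row-of-value _ rw w≢1 w≢t
  ... | ra , rra , ea | rb , rrb , eb = order (<-cmp ra rb)
    where
    only : ∀ r → φ n τ r j → r ≡ ra ⊎ r ≡ rb
    only r (rr , _ , inj₁ q) = inj₁ (row-unique r ra rr rra (trans q (sym ea)))
    only r (rr , _ , inj₂ q) = inj₂ (row-unique r rb rr rrb (trans q (sym eb)))
    order : Tri (ra < rb) (ra ≡ rb) (rb < ra) → TwoDotsInColumn (φ n τ) j
    order (tri< ra<rb _ _) = ra , rb , ra<rb , (rra , rj , inj₁ ea) , (rrb , rj , inj₂ eb) , only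
    order (tri≈ _ refl _) = ⊥-elim (even≢odd j j (trans (sym ea) (trans eb (odd-form j))))
    order (tri> _ _ rb<ra) =
      rb , ra , rb<ra , (rrb , rj , inj₂ eb) , (rra , rj , inj₁ ea) , λ r h → swap (only r h)

  dellac-from-band : (∀ r j → φ n τ r j → j ≤ r × r ≤ j + n) → IsDellac n (φ n τ)
  dellac-from-band band = record
    { in-grid = λ r j (rr , rj , _) → rr , rj
    ; one-per-row = one-per-row
    ; two-per-column = two-per-column
    ; band = band
    }

-- The Dumont inequalities give the band condition: σ(2r+2) < 2r+2 places the dot
-- of row r ≤ n in a column j ≤ r, and σ(2t+1) > 2t+1 places the dot of row
-- n+1+t in a column j ≥ t+1.
dumont⇒band : ∀ n τ → τ ∈𝔇 suc n → ∀ r j → φ n τ r j → j ≤ r × r ≤ j + n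
dumont⇒band n τ D r j (rr , (_ , j≤n) , c) with rowView n r rr
... | low _ r≤n =
  s≤s⁻¹ (*-cancelˡ-< 2 j (suc r) (≤-<-trans (InCol-lower j c) below)) , ≤-trans r≤n (m≤n+m n j)
  where
  below : τ (e n r) < 2 * suc r
  below rewrite e-low r≤n = IsDumont.even-cond D (suc r) (s≤s z≤n) (s≤s r≤n)
... | high t t<n refl = ≤-trans j≤n (m≤m+n n (suc t)) , subst (n + suc t ≤_) (+-comm n j) (+-monoʳ-≤ n t<j)
  where
  above : suc (2 * t) < τ (e n (n + suc t))
  above rewrite e-high n t = subst (λ z → z < τ z) (cong (_∸ 1) (double-suc t))
                               (IsDumont.odd-cond D (suc t) (s≤s z≤n) (s≤s (<⇒≤ t<n)))
  t<j : suc t ≤ j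
  t<j = *-cancelˡ-< 2 t j (s≤s⁻¹ (≤-trans above (InCol-upper j c)))

-- Conversely, for anchored τ the band condition of φ(τ) gives the Dumont
-- inequalities; at 2 and 2n+1 they hold by anchoring.
dellac⇒dumont : ∀ n τ → Anchored n τ → IsDellac n (φ n τ) → τ ∈𝔇 suc n
dellac⇒dumont n τ A Dl = record { perm = Anchored.perm A ; even-cond = even-cond ; odd-cond = odd-cond }
  where
  even-cond : ∀ i → 1 ≤ i → i ≤ suc n → τ (2 * i) < 2 * i
  even-cond (suc zero) _ _ rewrite Anchored.at-two A = s≤s (s≤s z≤n)
  even-cond (suc (suc r)) _ (s≤s r≤n) with IsDellac.one-per-row Dl (suc r) (low-row-range (s≤s z≤n) r≤n)
  ... | j , dot@(_ , _ , c) , _ = subst (λ z → τ z < 2 * suc (suc r)) (e-low r≤n)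
        (≤-<-trans (InCol-upper j c) (subst (suc (suc (2 * j)) ≤_) (sym (double-suc (suc r)))
          (s≤s (s≤s (*-monoʳ-≤ 2 (proj₁ (IsDellac.band Dl _ _ dot)))))))
  odd-cond : ∀ i → 1 ≤ i → i ≤ suc n → 2 * i ∸ 1 < τ (2 * i ∸ 1)
  odd-cond (suc t) _ (s≤s t≤n) with m≤n⇒m<n∨m≡n t≤n
  ... | inj₂ refl = subst (λ z → z < τ z) (sym (top-odd t))
        (subst (suc (2 * t) <_) (sym (Anchored.at-top A)) (≤-reflexive (sym (double-suc t))))
  ... | inj₁ t<n with IsDellac.one-per-row Dl (n + suc t) (high-row-range t<n)
  ... | j , dot@(_ , _ , c) , _ = subst (λ z → z < τ z) (sym (cong (_∸ 1) (double-suc t)))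
        (subst (λ z → suc (2 * t) < τ z) (e-high n t)
          (<-≤-trans (subst (_≤ 2 * j) (double-suc t) (*-monoʳ-≤ 2 t<j)) (InCol-lower j c)))
    where
    t<j : suc t ≤ j
    t<j = +-cancelˡ-≤ n (suc t) j (subst (n + suc t ≤_) (+-comm j n) (proj₂ (IsDellac.band Dl _ _ dot)))

dumont⇔dellac : ∀ n τ → Anchored n τ → (τ ∈𝔇 suc n ⇔ IsDellac n (φ n τ))
dumont⇔dellac n τ A = mk⇔ (λ D → AnchoredGrid.dellac-from-band n τ A (dumont⇒band n τ D))
                          (dellac⇒dumont n τ A)

≈G-sym : ∀ {G H} → G ≈G H → H ≈G G
≈G-sym G≈H r j = proj₂ (G≈H r j) , proj₁ (G≈H r j)

dellac-resp-≈G : ∀ n G H → G ≈G H → IsDellac n G → IsDellac n H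
dellac-resp-≈G n G H G≈H D = record
  { in-grid = λ r j h → IsDellac.in-grid D r j (from r j h)
  ; one-per-row = λ r rr → row (IsDellac.one-per-row D r rr)
  ; two-per-column = λ j rj → column j (IsDellac.two-per-column D j rj)
  ; band = λ r j h → IsDellac.band D r j (from r j h)
  }
  where
  to : ∀ r j → G r j → H r j
  to r j = proj₁ (G≈H r j)
  from : ∀ r j → H r j → G r j
  from r j = proj₂ (G≈H r j)
  row : ∀ {r} → SingleDotInRow G r → SingleDotInRow H r
  row {r} (j , g , u) = j , to r j g , λ j' h → u j' (from r j' h)
  column : ∀ j → TwoDotsInColumn G j → TwoDotsInColumn H j
  column j (r₁ , r₂ , lt , g₁ , g₂ , u) =
    r₁ , r₂ , lt , to r₁ j g₁ , to r₂ j g₂ , λ r h → u r (from r j h)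

φ-transp≈Sw : ∀ n σ i → InRange (2 * n) i → InRange (2 * n) (suc i) →
  φ n (σ ∘ᶠ transp (e n i) (e n (suc i))) ≈G Sw i (φ n σ)
φ-transp≈Sw n σ i ri rsi r j = to , from
  where
  a = e n i
  b = e n (suc i)
  move : ∀ {x y} → x ≡ y → InCol (σ x) j → InCol (σ y) j
  move = subst (λ z → InCol (σ z) j)
  untouched : ∀ {r} → InRange (2 * n) r → r ≢ i → r ≢ suc i → transp a b (e n r) ≡ e n r
  untouched {r} rr r≢i r≢si = transp-other a b (e n r)
    (λ q → r≢i (label-injective n r i rr ri q)) (λ q → r≢si (label-injective n r (suc i) rr rsi q))
  to : φ n (σ ∘ᶠ transp a b) r j → Sw i (φ n σ) r j
  to (rr , rj , c) with r ≟ i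
  ... | yes refl = inj₂ (inj₁ (refl , rsi , rj , move (transp-left a b) c))
  ... | no r≢i with r ≟ suc i
  ...   | yes refl = inj₂ (inj₂ (refl , ri , rj , move (transp-right a b) c))
  ...   | no r≢si = inj₁ (r≢i , r≢si , rr , rj , move (untouched rr r≢i r≢si) c)
  from : Sw i (φ n σ) r j → φ n (σ ∘ᶠ transp a b) r j
  from (inj₁ (r≢i , r≢si , rr , rj , c)) = rr , rj , move (sym (untouched rr r≢i r≢si)) c
  from (inj₂ (inj₁ (refl , _ , rj , c))) = ri , rj , move (sym (transp-left a b)) c
  from (inj₂ (inj₂ (refl , _ , rj , c))) = rsi , rj , move (sym (transp-right a b)) c

lemma2 : (n : ℕ) → 1 ≤ n → (σ : ℕ → ℕ) → σ ∈𝔇 suc n →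
    (i : ℕ) → 1 ≤ i → i ≤ 2 * n ∸ 1 →
    (Switchable n (φ n σ) i ⇔ ((σ ∘ᶠ transp (e n i) (e n (suc i))) ∈𝔇 suc n))
    × ((σ ∘ᶠ transp (e n i) (e n (suc i))) ∈𝔇 suc n →
    φ n (σ ∘ᶠ transp (e n i) (e n (suc i))) ≈G Sw i (φ n σ))
lemma2 n _ σ D i 1≤i i≤ =
  mk⇔ (λ sw → Equivalence.from dumont⇔dellac′ (dellac-resp-≈G n _ _ (≈G-sym φ′≈Sw) sw))
      (λ D′ → dellac-resp-≈G n _ _ φ′≈Sw (Equivalence.to dumont⇔dellac′ D′)) ,
  λ _ → φ′≈Sw
  where
  rows = adjacent-rows n i 1≤i i≤
  σ′ = σ ∘ᶠ transp (e n i) (e n (suc i))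
  φ′≈Sw : φ n σ′ ≈G Sw i (φ n σ)
  φ′≈Sw = φ-transp≈Sw n σ i (proj₁ rows) (proj₂ rows)
  dumont⇔dellac′ : σ′ ∈𝔇 suc n ⇔ IsDellac n (φ n σ′)
  dumont⇔dellac′ = dumont⇔dellac n σ′
    (anchored-transp n σ i (suc i) (dumont⇒anchored n σ D) (proj₁ rows) (proj₂ rows))
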